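{- If $D$ is a directed path or a directed cycle of order $n$, then $\gamma_I(D)=n$.
   Context: An Italian dominating function (IDF) on a digraph $D$ is a function $f:V(D)\to\{0,1,2\}$ such that every vertex $v$ with $f(v)=0$ has at least two in-neighbors $w$ with $f(w)=1$ or at least one in-neighbor $w$ with $f(w)=2$. Its weight is $\sum_{u\in V(D)}f(u)$, and the Italian domination number $\gamma_I(D)$ is the minimum weight of an IDF on $D$. -}

module Defs where

open import Data.Nat using (ℕ; suc; _≤_)
open import Data.Nat.ListAction using (sum)
open import Data.Fin using (Fin; toℕ)
open import Data.List using (map; allFin)
open import Data.Product using (Σ; ∃; ∃-syntax; _×_)
open import Data.Sum using (_⊎_)
open import Relation.Binary.PropositionalEquality using (_≡_; _≢_)

-- A (finite) digraph: vertex set Fin order, arc relation Arc u v meaning u → v.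
record Digraph : Set₁ where
  field
    order : ℕ
    Arc   : Fin order → Fin order → Set

open Digraph public

Labelling : Digraph → Set
Labelling D = Fin (order D) → Fin 3

IsIDF : (D : Digraph) → Labelling D → Set
IsIDF D f = ∀ v → toℕ (f v) ≡ 0 →
    (∃[ w ] (Arc D w v × toℕ (f w) ≡ 2))
  ⊎ (∃[ w₁ ] ∃[ w₂ ] (w₁ ≢ w₂ × Arc D w₁ v × Arc D w₂ v
                      × toℕ (f w₁) ≡ 1 × toℕ (f w₂) ≡ 1))

weight : (D : Digraph) → Labelling D → ℕ
weight D f = sum (map (λ u → toℕ (f u)) (allFin (order D)))

ItalianDominationNumber : Digraph → ℕ → Set
ItalianDominationNumber D k =
  (Σ (Labelling D) λ f → IsIDF D f × weight D f ≡ k)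
  × (∀ (f : Labelling D) → IsIDF D f → k ≤ weight D f)

DirectedPath : ℕ → Digraph
DirectedPath n = record
  { order = n
  ; Arc   = λ i j → toℕ j ≡ suc (toℕ i) }

-- Directed cycle C_n : 0 → 1 → ... → n-1 → 0   (used with n ≥ 2)
DirectedCycle : ℕ → Digraph
DirectedCycle n = record
  { order = n
  ; Arc   = λ i j → toℕ j ≡ suc (toℕ i)
                  ⊎ (suc (toℕ i) ≡ n × toℕ j ≡ 0) }

{-# OPTIONS --safe #-}
module Submission where

-- The constant labelling 1 is an IDF of weight n. Conversely, every vertex of a
-- directed path or cycle has at most one in-neighbour, so a vertex labelled 0
-- forces its predecessor to be labelled 2. Since x + [x = 0] = 1 + [x = 2] for
-- x ≤ 2, summing along the path 0 → 1 → ⋯ → n-1 and using [f(i+1) = 0] ≤ [f(i) = 2]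
-- telescopes to  n + [f(n-1) = 2] ≤ weight f + [f(0) = 0].  In the path the source 0
-- cannot be labelled 0, and in the cycle [f(0) = 0] ≤ [f(n-1) = 2] by the closing arc.

open import Defs
open import Data.Nat using (ℕ; zero; suc; _+_; _≤_; z≤n; s≤s)
open import Data.Nat.Properties
open import Data.Nat.ListAction using (sum)
open import Data.Product using (_×_; _,_)
open import Data.Sum using (inj₁; inj₂)
open import Data.Fin using (Fin; toℕ; inject₁; fromℕ) renaming (zero to fzero; suc to fsuc)
open import Data.Fin.Properties using (toℕ-injective; toℕ-inject₁; toℕ-fromℕ)
open import Data.List using (tabulate)
open import Data.List.Properties using (map-tabulate)
open import Data.Empty using (⊥-elim)
open import Function using (_∘_)
open import Relation.Binary.PropositionalEquality

isZero : ℕ → ℕ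
isZero zero    = 1
isZero (suc _) = 0

isTwo : ℕ → ℕ
isTwo 2 = 1
isTwo _ = 0

suc-isTwo≤+isZero : ∀ x → suc (isTwo x) ≤ x + isZero x
suc-isTwo≤+isZero 0                   = ≤-refl
suc-isTwo≤+isZero 1                   = ≤-refl
suc-isTwo≤+isZero 2                   = ≤-refl
suc-isTwo≤+isZero (suc (suc (suc x))) = s≤s z≤n

isZero≤isTwo : ∀ {x y} → (y ≡ 0 → x ≡ 2) → isZero y ≤ isTwo x
isZero≤isTwo {y = zero}  forced rewrite forced refl = ≤-refl
isZero≤isTwo {y = suc _} forced = z≤n

sum-tabulate-chain : ∀ n (g : Fin (suc n) → ℕ) →
  (∀ (i : Fin n) → g (fsuc i) ≡ 0 → g (inject₁ i) ≡ 2) →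
  suc n + isTwo (g (fromℕ n)) ≤ sum (tabulate g) + isZero (g fzero)
sum-tabulate-chain zero g _ = ≤-trans (suc-isTwo≤+isZero (g fzero))
                                      (≤-reflexive (cong (_+ isZero (g fzero)) (sym (+-identityʳ (g fzero)))))
sum-tabulate-chain (suc n) g chain = begin
  suc (suc n + isTwo (g (fromℕ (suc n))))  ≤⟨ s≤s (sum-tabulate-chain n (g ∘ fsuc) (chain ∘ fsuc)) ⟩
  suc (rest + isZero (g (fsuc fzero)))     ≤⟨ s≤s (+-monoʳ-≤ rest (isZero≤isTwo (chain fzero))) ⟩
  suc (rest + isTwo x)                     ≡⟨ cong suc (+-comm rest (isTwo x)) ⟩
  suc (isTwo x) + rest                     ≤⟨ +-monoˡ-≤ rest (suc-isTwo≤+isZero x) ⟩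
  x + isZero x + rest                      ≡⟨ +-assoc x (isZero x) rest ⟩
  x + (isZero x + rest)                    ≡⟨ cong (x +_) (+-comm (isZero x) rest) ⟩
  x + (rest + isZero x)                    ≡⟨ sym (+-assoc x rest (isZero x)) ⟩
  x + rest + isZero x                      ∎
  where
  open ≤-Reasoning
  x    = g fzero
  rest = sum (tabulate (g ∘ fsuc))

label : (D : Digraph) → Labelling D → Fin (order D) → ℕ
label D f = toℕ ∘ f

weight-tabulate : ∀ D (f : Labelling D) → weight D f ≡ sum (tabulate (label D f))
weight-tabulate D f = cong sum (map-tabulate (λ u → u) (label D f))

UniqueInNeighbours : Digraph → Set
UniqueInNeighbours D = ∀ {u w v} → Arc D u v → Arc D w v → u ≡ w

IsIDF⇒in-neighbour≡2 : ∀ D (f : Labelling D) → UniqueInNeighbours D → IsIDF D f →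
  ∀ {u v} → Arc D u v → label D f v ≡ 0 → label D f u ≡ 2
IsIDF⇒in-neighbour≡2 D f unique idf u→v fv≡0 with idf _ fv≡0
... | inj₁ (w , w→v , fw≡2)                   = subst (λ x → label D f x ≡ 2) (unique w→v u→v) fw≡2
... | inj₂ (w₁ , w₂ , w₁≢w₂ , w₁→v , w₂→v , _) = ⊥-elim (w₁≢w₂ (unique w₁→v w₂→v))

constantOne : ∀ D → Labelling D
constantOne D _ = fsuc fzero

constantOne-isIDF : ∀ D → IsIDF D (constantOne D)
constantOne-isIDF D v ()

constantOne-weight : ∀ D → weight D (constantOne D) ≡ order D
constantOne-weight D = trans (weight-tabulate D (constantOne D)) (sum-ones (order D))
  where
  sum-ones : ∀ n → sum (tabulate {n = n} (λ _ → 1)) ≡ n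
  sum-ones zero    = refl
  sum-ones (suc n) = cong suc (sum-ones n)

ItalianDominationNumber-order : ∀ D → (∀ f → IsIDF D f → order D ≤ weight D f) →
  ItalianDominationNumber D (order D)
ItalianDominationNumber-order D lower =
  (constantOne D , constantOne-isIDF D , constantOne-weight D) , lower

inject₁→suc : ∀ {n} (i : Fin n) → toℕ (fsuc i) ≡ suc (toℕ (inject₁ i))
inject₁→suc i = cong suc (sym (toℕ-inject₁ i))

path-uniqueInNeighbours : ∀ n → UniqueInNeighbours (DirectedPath n)
path-uniqueInNeighbours n u→v w→v = toℕ-injective (suc-injective (trans (sym u→v) w→v))

cycle-uniqueInNeighbours : ∀ n → UniqueInNeighbours (DirectedCycle n)
cycle-uniqueInNeighbours n (inj₁ u→v)      (inj₁ w→v)      = toℕ-injective (suc-injective (trans (sym u→v) w→v))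
cycle-uniqueInNeighbours n (inj₁ u→v)      (inj₂ (_ , v≡0)) with () ← trans (sym u→v) v≡0
cycle-uniqueInNeighbours n (inj₂ (_ , v≡0)) (inj₁ w→v)      with () ← trans (sym w→v) v≡0
cycle-uniqueInNeighbours n (inj₂ (u≡n , _)) (inj₂ (w≡n , _)) = toℕ-injective (suc-injective (trans u≡n (sym w≡n)))

path-lowerBound : ∀ n f → IsIDF (DirectedPath n) f → n ≤ weight (DirectedPath n) f
path-lowerBound zero    f idf = z≤n
path-lowerBound (suc m) f idf = begin
  suc m                                ≤⟨ m≤m+n (suc m) _ ⟩
  suc m + isTwo (g (fromℕ m))          ≤⟨ sum-tabulate-chain m g chain ⟩
  sum (tabulate g) + isZero (g fzero)  ≡⟨ cong (sum (tabulate g) +_) source-nonzero ⟩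
  sum (tabulate g) + 0                 ≡⟨ +-identityʳ _ ⟩
  sum (tabulate g)                     ≡⟨ sym (weight-tabulate D f) ⟩
  weight D f                           ∎
  where
  open ≤-Reasoning
  D = DirectedPath (suc m)
  g = label D f
  chain : ∀ (i : Fin m) → g (fsuc i) ≡ 0 → g (inject₁ i) ≡ 2
  chain i = IsIDF⇒in-neighbour≡2 D f (path-uniqueInNeighbours (suc m)) idf (inject₁→suc i)
  source-nonzero : isZero (g fzero) ≡ 0
  source-nonzero with g fzero in g0
  ... | suc _ = refl
  ... | zero with idf fzero g0
  ...   | inj₁ (_ , () , _)
  ...   | inj₂ (_ , _ , _ , () , _)

cycle-lowerBound : ∀ n f → IsIDF (DirectedCycle n) f → n ≤ weight (DirectedCycle n) f
cycle-lowerBound zero    f idf = z≤n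
cycle-lowerBound (suc m) f idf = subst (suc m ≤_) (sym (weight-tabulate D f)) (+-cancelʳ-≤ closing (suc m) total bound)
  where
  open ≤-Reasoning
  D       = DirectedCycle (suc m)
  g       = label D f
  total   = sum (tabulate g)
  closing = isTwo (g (fromℕ m))
  in-neighbour≡2 = IsIDF⇒in-neighbour≡2 D f (cycle-uniqueInNeighbours (suc m)) idf
  chain : ∀ (i : Fin m) → g (fsuc i) ≡ 0 → g (inject₁ i) ≡ 2
  chain i = in-neighbour≡2 (inj₁ (inject₁→suc i))
  bound : suc m + closing ≤ total + closing
  bound = begin
    suc m + closing            ≤⟨ sum-tabulate-chain m g chain ⟩
    total + isZero (g fzero)   ≤⟨ +-monoʳ-≤ total (isZero≤isTwo (in-neighbour≡2 (inj₂ (cong suc (toℕ-fromℕ m) , refl)))) ⟩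
    total + closing            ∎

corollary2p6 : (n : ℕ)
    → ItalianDominationNumber (DirectedPath n) n
      × (2 ≤ n → ItalianDominationNumber (DirectedCycle n) n)
corollary2p6 n =
    ItalianDominationNumber-order (DirectedPath n) (path-lowerBound n)
  , λ _ → ItalianDominationNumber-order (DirectedCycle n) (cycle-lowerBound n)
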